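{- Let $\mathfrak A$ be a J-algebra and let $a,b\in A$ satisfy $a^{\smile};a\le1'$, $b^{\smile};b\le1'$, $1=a^{\smile};b$, $1=a;1=b;1$, and $a;a^{\smile}\cdot b;b^{\smile}\le1'$. Let $$A=a;(a^{\smile})^2\cdot b;a;b^{\smile};a^{\smile}\cdot b^2;b^{\smile},\qquad B=a;a^{\smile}\cdot b;a;(a^{\smile})^2;b^{\smile}\cdot b^2;a;b^{\smile};a^{\smile};b^{\smile}\cdot b^3;(b^{\smile})^2.$$ Then $[B^{\smile};A,\;A;B;A^{\smile}]=1'=[B^{\smile};A,\;A^2;B;(A^{\smile})^2]$, where $[X,Y]=X;Y;X^{\smile};Y^{\smile}$.
   Context: A J-algebra is an algebra $\langle A,\cdot,0,1,;,{}^{\smile},1'\rangle$ satisfying for all $x,y,z$: $x\cdot(y\cdot z)=(x\cdot y)\cdot z$, $x\cdot y=y\cdot x$, $x\cdot x=x$, $x;(y;z)=(x;y);z$, $x;1'=x$, $(x\cdot y);z=(x\cdot y);z\cdot y;z$, $x^{\smile\smile}=x$, $(x;y)^{\smile}=y^{\smile};x^{\smile}$, $(x\cdot y)^{\smile}=x^{\smile}\cdot y^{\smile}$, $x;y\cdot z=(z;y^{\smile}\cdot x);(y\cdot x^{\smile};z)\cdot z$, $0\cdot x=0$, $x\cdot1=x$, $x;0=0$. Converse binds tightest, then $;$, then $\cdot$; $x^n$ is the $n$-fold relative product. $x\le y$ means $x\cdot y=x$. (The element named $A$ is distinct from the universe $A$.) -}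

module Defs where

open import Level using (Level; suc; _⊔_)
open import Relation.Binary.PropositionalEquality using (_≡_)

record JAlgebra (c : Level) : Set (suc c) where
  infixl 7 _·_
  infixl 8 _⨾_
  infix 9 _˘
  field
    Carrier : Set c
    _·_ : Carrier → Carrier → Carrier
    𝟘 𝟙 : Carrier
    _⨾_ : Carrier → Carrier → Carrier
    _˘ : Carrier → Carrier
    1' : Carrier
    ·-assoc : ∀ x y z → x · (y · z) ≡ (x · y) · z
    ·-comm : ∀ x y → x · y ≡ y · x
    ·-idem : ∀ x → x · x ≡ x
    ⨾-assoc : ∀ x y z → x ⨾ (y ⨾ z) ≡ (x ⨾ y) ⨾ z
    ⨾-identityʳ : ∀ x → x ⨾ 1' ≡ x
    ⨾-·-ax : ∀ x y z → (x · y) ⨾ z ≡ (x · y) ⨾ z · y ⨾ z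
    ˘-invol : ∀ x → x ˘ ˘ ≡ x
    ˘-⨾ : ∀ x y → (x ⨾ y) ˘ ≡ y ˘ ⨾ x ˘
    ˘-· : ∀ x y → (x · y) ˘ ≡ x ˘ · y ˘
    modular : ∀ x y z → x ⨾ y · z ≡ (z ⨾ y ˘ · x) ⨾ (y · x ˘ ⨾ z) · z
    𝟘-zeroˡ : ∀ x → 𝟘 · x ≡ 𝟘
    𝟙-identityʳ : ∀ x → x · 𝟙 ≡ x
    ⨾-zeroʳ : ∀ x → x ⨾ 𝟘 ≡ 𝟘

  infix 4 _≤_
  _≤_ : Carrier → Carrier → Set c
  x ≤ y = x · y ≡ x

  [_,_] : Carrier → Carrier → Carrier
  [ X , Y ] = X ⨾ Y ⨾ X ˘ ⨾ Y ˘

-- The hypotheses make a and b total functions that are the two projections of a product: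
-- w ↦ (a w, b w) is onto by a˘ ; b = 𝟙 and one-to-one by a ; a˘ · b ; b˘ ≤ 1'.  Hence every
-- functional total h is the unique pair h ; a ˘ · h ; b ˘ of its components h ; a and h ; b.
-- Iterating the pairing, a binary tree whose leaves are labelled by words in a and b denotes
-- a functional total element acting on words by prefix replacement, exactly as tree-pair
-- diagrams act in Thompson's group F; A and B are the diagrams of the generators x₀ and x₁.
-- So a product of generators and their converses is 1' as soon as it fixes every word of some
-- length, and the two relations of F are verified by running the prefix replacements on all
-- words of length 4 and 5.
module Submission where

open import Defs
open import Level using (Level)
open import Data.Product using (_×_; _,_)
open import Data.List using (List; []; _∷_; _++_; _∷ʳ_; foldl; map; reverse)
open import Data.List.Properties using (unfold-reverse)
import Data.List.Properties as List
open import Data.Maybe using (Maybe; just; nothing; _>>=_)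
import Data.Maybe.Properties as Maybe
open import Data.Nat using (ℕ; zero; suc)
open import Relation.Nullary.Decidable using (Dec; yes; no; _×-dec_; True; toWitness)
open import Relation.Binary.Definitions using (DecidableEquality)
open import Relation.Binary.PropositionalEquality
  using (_≡_; refl; sym; trans; cong; cong₂; subst; subst₂; module ≡-Reasoning)

data Letter : Set where
  𝐚 𝐛 : Letter

_≟ˡ_ : DecidableEquality Letter
𝐚 ≟ˡ 𝐚 = yes refl
𝐚 ≟ˡ 𝐛 = no λ ()
𝐛 ≟ˡ 𝐚 = no λ ()
𝐛 ≟ˡ 𝐛 = yes refl

Word : Set
Word = List Letter

data Tree : Set where
  leaf : Word → Tree
  node : Tree → Tree → Tree

act : Tree → Word → Maybe Word
act (leaf w)   p       = just (w ++ p)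
act (node l r) []      = nothing
act (node l r) (𝐚 ∷ p) = act l p
act (node l r) (𝐛 ∷ p) = act r p

data Gen : Set where
  x₀ x₁ x₀⁻¹ x₁⁻¹ : Gen

diagram : Gen → Tree
diagram x₀   = node (node (leaf (𝐚 ∷ [])) (leaf (𝐛 ∷ 𝐚 ∷ []))) (leaf (𝐛 ∷ 𝐛 ∷ []))
diagram x₀⁻¹ = node (leaf (𝐚 ∷ 𝐚 ∷ [])) (node (leaf (𝐚 ∷ 𝐛 ∷ [])) (leaf (𝐛 ∷ [])))
diagram x₁   = node (leaf (𝐚 ∷ []))
                    (node (node (leaf (𝐛 ∷ 𝐚 ∷ [])) (leaf (𝐛 ∷ 𝐛 ∷ 𝐚 ∷ []))) (leaf (𝐛 ∷ 𝐛 ∷ 𝐛 ∷ [])))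
diagram x₁⁻¹ = node (leaf (𝐚 ∷ []))
                    (node (leaf (𝐛 ∷ 𝐚 ∷ 𝐚 ∷ [])) (node (leaf (𝐛 ∷ 𝐚 ∷ 𝐛 ∷ [])) (leaf (𝐛 ∷ 𝐛 ∷ []))))

inv : Gen → Gen
inv x₀   = x₀⁻¹
inv x₁   = x₁⁻¹
inv x₀⁻¹ = x₀
inv x₁⁻¹ = x₁

inv-involutive : ∀ g → inv (inv g) ≡ g
inv-involutive x₀   = refl
inv-involutive x₁   = refl
inv-involutive x₀⁻¹ = refl
inv-involutive x₁⁻¹ = refl

invs : List Gen → List Gen
invs gs = reverse (map inv gs)

-- The last generator of the list acts first, matching the relative product of the list.
act* : List Gen → Word → Maybe Word
act* []       p = just p
act* (g ∷ gs) p = act* gs p >>= act (diagram g)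

FixesExtensions : List Gen → ℕ → Word → Set
FixesExtensions gs zero    p = act* gs p ≡ just p
FixesExtensions gs (suc n) p = FixesExtensions gs n (p ∷ʳ 𝐚) × FixesExtensions gs n (p ∷ʳ 𝐛)

fixesExtensions? : ∀ gs n p → Dec (FixesExtensions gs n p)
fixesExtensions? gs zero    p = Maybe.≡-dec (List.≡-dec _≟ˡ_) (act* gs p) (just p)
fixesExtensions? gs (suc n) p = fixesExtensions? gs n (p ∷ʳ 𝐚) ×-dec fixesExtensions? gs n (p ∷ʳ 𝐛)

infixl 7 _∙_
infix 8 _⁻¹

data Term : Set where
  gen : Gen → Term
  _∙_ : Term → Term → Term
  _⁻¹ : Term → Term

commutator : Term → Term → Term
commutator s t = s ∙ t ∙ s ⁻¹ ∙ t ⁻¹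

flatten : Term → List Gen
flatten (gen g) = g ∷ []
flatten (s ∙ t) = flatten s ++ flatten t
flatten (t ⁻¹)  = invs (flatten t)

module JAlgebraProperties {c : Level} (𝔄 : JAlgebra c) where
  open JAlgebra 𝔄
  open ≡-Reasoning

  ≤-reflexive : ∀ {x y} → x ≡ y → x ≤ y
  ≤-reflexive {x} refl = ·-idem x

  ≤-trans : ∀ {x y z} → x ≤ y → y ≤ z → x ≤ z
  ≤-trans {x} {y} {z} x≤y y≤z = begin
    x · z       ≡⟨ cong (_· z) (sym x≤y) ⟩
    x · y · z   ≡⟨ sym (·-assoc x y z) ⟩
    x · (y · z) ≡⟨ cong (x ·_) y≤z ⟩
    x · y       ≡⟨ x≤y ⟩
    x           ∎

  ≤-antisym : ∀ {x y} → x ≤ y → y ≤ x → x ≡ y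
  ≤-antisym {x} {y} x≤y y≤x = trans (sym x≤y) (trans (·-comm x y) y≤x)

  x·y≤x : ∀ {x y} → x · y ≤ x
  x·y≤x {x} {y} = trans (·-comm (x · y) x) (trans (·-assoc x x y) (cong (_· y) (·-idem x)))

  x·y≤y : ∀ {x y} → x · y ≤ y
  x·y≤y {x} {y} = trans (sym (·-assoc x y y)) (cong (x ·_) (·-idem y))

  ·-greatest : ∀ {x y z} → x ≤ y → x ≤ z → x ≤ y · z
  ·-greatest {x} {y} {z} x≤y x≤z = trans (·-assoc x y z) (trans (cong (_· z) x≤y) x≤z)

  ·-monoˡ-≤ : ∀ {x y z} → x ≤ y → x · z ≤ y · z
  ·-monoˡ-≤ x≤y = ·-greatest (≤-trans x·y≤x x≤y) x·y≤y

  x≤𝟙 : ∀ {x} → x ≤ 𝟙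
  x≤𝟙 {x} = 𝟙-identityʳ x

  𝟙-identityˡ : ∀ x → 𝟙 · x ≡ x
  𝟙-identityˡ x = trans (·-comm 𝟙 x) (𝟙-identityʳ x)

  ˘-mono-≤ : ∀ {x y} → x ≤ y → x ˘ ≤ y ˘
  ˘-mono-≤ {x} {y} x≤y = trans (sym (˘-· x y)) (cong _˘ x≤y)

  ˘-⨾-˘ : ∀ x y → (x ˘ ⨾ y ˘) ˘ ≡ y ⨾ x
  ˘-⨾-˘ x y = trans (˘-⨾ (x ˘) (y ˘)) (cong₂ _⨾_ (˘-invol y) (˘-invol x))

  ⨾-monoˡ-≤ : ∀ {x y z} → x ≤ y → x ⨾ z ≤ y ⨾ z
  ⨾-monoˡ-≤ {x} {y} {z} x≤y = begin
    x ⨾ z · y ⨾ z       ≡⟨ cong (λ t → t ⨾ z · y ⨾ z) (sym x≤y) ⟩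
    (x · y) ⨾ z · y ⨾ z ≡⟨ sym (⨾-·-ax x y z) ⟩
    (x · y) ⨾ z         ≡⟨ cong (_⨾ z) x≤y ⟩
    x ⨾ z               ∎

  ⨾-monoʳ-≤ : ∀ {x y z} → x ≤ y → z ⨾ x ≤ z ⨾ y
  ⨾-monoʳ-≤ {x} {y} {z} x≤y =
    subst₂ _≤_ (˘-⨾-˘ x z) (˘-⨾-˘ y z) (˘-mono-≤ (⨾-monoˡ-≤ (˘-mono-≤ x≤y)))

  ⨾-mono-≤ : ∀ {x x′ y y′} → x ≤ x′ → y ≤ y′ → x ⨾ y ≤ x′ ⨾ y′
  ⨾-mono-≤ x≤x′ y≤y′ = ≤-trans (⨾-monoˡ-≤ x≤x′) (⨾-monoʳ-≤ y≤y′)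

  ˘-1' : 1' ˘ ≡ 1'
  ˘-1' = begin
    1' ˘            ≡⟨ sym (⨾-identityʳ (1' ˘)) ⟩
    1' ˘ ⨾ 1'       ≡⟨ cong (1' ˘ ⨾_) (sym (˘-invol 1')) ⟩
    1' ˘ ⨾ 1' ˘ ˘   ≡⟨ sym (˘-⨾ (1' ˘) 1') ⟩
    (1' ˘ ⨾ 1') ˘   ≡⟨ cong _˘ (⨾-identityʳ (1' ˘)) ⟩
    1' ˘ ˘          ≡⟨ ˘-invol 1' ⟩
    1'              ∎

  ⨾-identityˡ : ∀ x → 1' ⨾ x ≡ x
  ⨾-identityˡ x = begin
    1' ⨾ x          ≡⟨ sym (˘-⨾-˘ x 1') ⟩
    (x ˘ ⨾ 1' ˘) ˘  ≡⟨ cong (λ t → (x ˘ ⨾ t) ˘) ˘-1' ⟩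
    (x ˘ ⨾ 1') ˘    ≡⟨ cong _˘ (⨾-identityʳ (x ˘)) ⟩
    x ˘ ˘           ≡⟨ ˘-invol x ⟩
    x               ∎

  ˘-𝟙 : 𝟙 ˘ ≡ 𝟙
  ˘-𝟙 = ≤-antisym x≤𝟙 (subst (_≤ 𝟙 ˘) (˘-invol 𝟙) (˘-mono-≤ x≤𝟙))

  modular-≤ : ∀ x y z → x ⨾ y · z ≤ (z ⨾ y ˘ · x) ⨾ (y · x ˘ ⨾ z)
  modular-≤ x y z = subst (_≤ (z ⨾ y ˘ · x) ⨾ (y · x ˘ ⨾ z)) (sym (modular x y z)) x·y≤x

  Functional Injective Total : Carrier → Set c
  Functional f = f ˘ ⨾ f ≤ 1'
  Injective f = f ⨾ f ˘ ≤ 1'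
  Total f = f ⨾ 𝟙 ≡ 𝟙

  functional⇒˘-injective : ∀ {f} → Functional f → Injective (f ˘)
  functional⇒˘-injective {f} f-fun = subst (λ t → f ˘ ⨾ t ≤ 1') (sym (˘-invol f)) f-fun

  1'-functional : Functional 1'
  1'-functional = ≤-reflexive (trans (⨾-identityʳ (1' ˘)) ˘-1')

  functional-⨾˘⨾-≤ : ∀ {f} u v → Functional f → (u ⨾ f ˘) ⨾ (f ⨾ v) ≤ u ⨾ v
  functional-⨾˘⨾-≤ {f} u v f-fun =
    subst₂ _≤_ regroup (cong (u ⨾_) (⨾-identityˡ v)) (⨾-monoʳ-≤ (⨾-monoˡ-≤ f-fun))
    where
    regroup : u ⨾ ((f ˘ ⨾ f) ⨾ v) ≡ (u ⨾ f ˘) ⨾ (f ⨾ v)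
    regroup = trans (cong (u ⨾_) (sym (⨾-assoc (f ˘) f v))) (⨾-assoc u (f ˘) (f ⨾ v))

  ⨾-functional : ∀ {f g} → Functional f → Functional g → Functional (f ⨾ g)
  ⨾-functional {f} {g} f-fun g-fun = ≤-trans
    (subst (_≤ g ˘ ⨾ g) (cong (_⨾ (f ⨾ g)) (sym (˘-⨾ f g))) (functional-⨾˘⨾-≤ (g ˘) g f-fun))
    g-fun

  total-⨾-≡𝟙 : ∀ {f u v} → Total f → u ⨾ v ≡ 𝟙 → f ⨾ u ⨾ v ≡ 𝟙
  total-⨾-≡𝟙 {f} {u} {v} f-tot u⨾v≡𝟙 = trans (sym (⨾-assoc f u v)) (trans (cong (f ⨾_) u⨾v≡𝟙) f-tot)

  total⇒1'≤⨾˘ : ∀ {f} → Total f → 1' ≤ f ⨾ f ˘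
  total⇒1'≤⨾˘ {f} f-tot = subst₂ _≤_ f⨾𝟙·1'≡1' (cong (f ⨾_) (⨾-identityʳ (f ˘)))
    (≤-trans (modular-≤ f 𝟙 1') (⨾-mono-≤ x·y≤y x·y≤y))
    where
    f⨾𝟙·1'≡1' : f ⨾ 𝟙 · 1' ≡ 1'
    f⨾𝟙·1'≡1' = trans (cong (_· 1') f-tot) (𝟙-identityˡ 1')

  ⨾-distribˡ-· : ∀ {f} → Functional f → ∀ x y → f ⨾ (x · y) ≡ f ⨾ x · f ⨾ y
  ⨾-distribˡ-· {f} f-fun x y = ≤-antisym
    (·-greatest (⨾-monoʳ-≤ x·y≤x) (⨾-monoʳ-≤ x·y≤y))
    (≤-trans (modular-≤ f x (f ⨾ y)) (⨾-mono-≤ x·y≤y (·-greatest x·y≤x (≤-trans x·y≤y f˘⨾f⨾y≤y))))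
    where
    f˘⨾f⨾y≤y : f ˘ ⨾ (f ⨾ y) ≤ y
    f˘⨾f⨾y≤y = subst₂ _≤_ (sym (⨾-assoc (f ˘) f y)) (⨾-identityˡ y) (⨾-monoˡ-≤ f-fun)

  ⨾-distribʳ-· : ∀ {z} → Injective z → ∀ x y → (x · y) ⨾ z ≡ x ⨾ z · y ⨾ z
  ⨾-distribʳ-· {z} z-inj x y = ≤-antisym
    (·-greatest (⨾-monoˡ-≤ x·y≤x) (⨾-monoˡ-≤ x·y≤y))
    (subst (x ⨾ z · y ⨾ z ≤_) (cong (_⨾ z) (·-comm y x))
      (≤-trans (modular-≤ x z (y ⨾ z)) (⨾-mono-≤ (·-monoˡ-≤ y⨾z⨾z˘≤y) x·y≤x)))
    where
    y⨾z⨾z˘≤y : y ⨾ z ⨾ z ˘ ≤ y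
    y⨾z⨾z˘≤y = subst₂ _≤_ (⨾-assoc y z (z ˘)) (⨾-identityʳ y) (⨾-monoʳ-≤ z-inj)

  functional-·-⨾˘-⨾ : ∀ {u} → Functional u → ∀ x y → (x · y ⨾ u ˘) ⨾ u ≡ x ⨾ u · y
  functional-·-⨾˘-⨾ {u} u-fun x y = ≤-antisym
    (·-greatest (⨾-monoˡ-≤ x·y≤x) (≤-trans (⨾-monoˡ-≤ x·y≤y) y⨾u˘⨾u≤y))
    (subst (x ⨾ u · y ≤_) (cong (_⨾ u) (·-comm (y ⨾ u ˘) x))
      (≤-trans (modular-≤ x u y) (⨾-monoʳ-≤ x·y≤x)))
    where
    y⨾u˘⨾u≤y : y ⨾ u ˘ ⨾ u ≤ y
    y⨾u˘⨾u≤y = subst₂ _≤_ (⨾-assoc y (u ˘) u) (⨾-identityʳ y) (⨾-monoʳ-≤ u-fun)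

  ˘-unique : ∀ {x y} → Functional x → Functional y → x ⨾ y ≡ 1' → y ⨾ x ≡ 1' → x ˘ ≡ y
  ˘-unique {x} {y} x-fun y-fun x⨾y≡1' y⨾x≡1' =
    ≤-antisym (˘≤ x-fun x⨾y≡1') (subst (_≤ x ˘) (˘-invol y) (˘-mono-≤ (˘≤ y-fun y⨾x≡1')))
    where
    ˘≤ : ∀ {u v} → Functional u → u ⨾ v ≡ 1' → u ˘ ≤ v
    ˘≤ {u} {v} u-fun u⨾v≡1' = subst₂ _≤_ u˘⨾u⨾v≡u˘ (⨾-identityˡ v) (⨾-monoˡ-≤ u-fun)
      where
      u˘⨾u⨾v≡u˘ : u ˘ ⨾ u ⨾ v ≡ u ˘
      u˘⨾u⨾v≡u˘ = trans (sym (⨾-assoc (u ˘) u v))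
                    (trans (cong (u ˘ ⨾_) u⨾v≡1') (⨾-identityʳ (u ˘)))

module JAlgebraPairing {c : Level} (𝔄 : JAlgebra c) where
  open JAlgebra 𝔄
  open JAlgebraProperties 𝔄
  open ≡-Reasoning

  module Pairing (a b : Carrier) (a-functional : Functional a) (b-functional : Functional b)
                 (a˘⨾b≡𝟙 : a ˘ ⨾ b ≡ 𝟙) (a-total : Total a) (b-total : Total b)
                 (a⨾a˘·b⨾b˘≤1' : a ⨾ a ˘ · b ⨾ b ˘ ≤ 1') where

    pair : Carrier → Carrier → Carrier
    pair f g = f ⨾ a ˘ · g ⨾ b ˘

    b˘⨾a≡𝟙 : b ˘ ⨾ a ≡ 𝟙
    b˘⨾a≡𝟙 = begin
      b ˘ ⨾ a       ≡⟨ cong (b ˘ ⨾_) (sym (˘-invol a)) ⟩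
      b ˘ ⨾ a ˘ ˘   ≡⟨ sym (˘-⨾ (a ˘) b) ⟩
      (a ˘ ⨾ b) ˘   ≡⟨ cong _˘ a˘⨾b≡𝟙 ⟩
      𝟙 ˘           ≡⟨ ˘-𝟙 ⟩
      𝟙             ∎

    1'≡a⨾a˘·b⨾b˘ : 1' ≡ a ⨾ a ˘ · b ⨾ b ˘
    1'≡a⨾a˘·b⨾b˘ = ≤-antisym (·-greatest (total⇒1'≤⨾˘ a-total) (total⇒1'≤⨾˘ b-total)) a⨾a˘·b⨾b˘≤1'

    functional-≡pair : ∀ {f} → Functional f → f ≡ pair (f ⨾ a) (f ⨾ b)
    functional-≡pair {f} f-fun = begin
      f                             ≡⟨ sym (⨾-identityʳ f) ⟩
      f ⨾ 1'                        ≡⟨ cong (f ⨾_) 1'≡a⨾a˘·b⨾b˘ ⟩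
      f ⨾ (a ⨾ a ˘ · b ⨾ b ˘)       ≡⟨ ⨾-distribˡ-· f-fun (a ⨾ a ˘) (b ⨾ b ˘) ⟩
      f ⨾ (a ⨾ a ˘) · f ⨾ (b ⨾ b ˘) ≡⟨ cong₂ _·_ (⨾-assoc f a (a ˘)) (⨾-assoc f b (b ˘)) ⟩
      pair (f ⨾ a) (f ⨾ b)          ∎

    functional-ext : ∀ {f g} → Functional f → Functional g → f ⨾ a ≡ g ⨾ a → f ⨾ b ≡ g ⨾ b → f ≡ g
    functional-ext f-fun g-fun f⨾a≡g⨾a f⨾b≡g⨾b =
      trans (functional-≡pair f-fun) (trans (cong₂ pair f⨾a≡g⨾a f⨾b≡g⨾b) (sym (functional-≡pair g-fun)))

    pair-⨾-a : ∀ {f g} → Total g → pair f g ⨾ a ≡ f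
    pair-⨾-a {f} {g} g-tot = begin
      (f ⨾ a ˘ · g ⨾ b ˘) ⨾ a ≡⟨ cong (_⨾ a) (·-comm (f ⨾ a ˘) (g ⨾ b ˘)) ⟩
      (g ⨾ b ˘ · f ⨾ a ˘) ⨾ a ≡⟨ functional-·-⨾˘-⨾ a-functional (g ⨾ b ˘) f ⟩
      g ⨾ b ˘ ⨾ a · f         ≡⟨ cong (_· f) (total-⨾-≡𝟙 g-tot b˘⨾a≡𝟙) ⟩
      𝟙 · f                   ≡⟨ 𝟙-identityˡ f ⟩
      f                       ∎

    pair-⨾-b : ∀ {f g} → Total f → pair f g ⨾ b ≡ g
    pair-⨾-b {f} {g} f-tot = begin
      (f ⨾ a ˘ · g ⨾ b ˘) ⨾ b ≡⟨ functional-·-⨾˘-⨾ b-functional (f ⨾ a ˘) g ⟩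
      f ⨾ a ˘ ⨾ b · g         ≡⟨ cong (_· g) (total-⨾-≡𝟙 f-tot a˘⨾b≡𝟙) ⟩
      𝟙 · g                   ≡⟨ 𝟙-identityˡ g ⟩
      g                       ∎

    pair-total : ∀ {f g} → Total f → Total g → Total (pair f g)
    pair-total {f} {g} f-tot g-tot = ≤-antisym x≤𝟙
      (subst (_≤ pair f g ⨾ 𝟙) pair⨾a⨾𝟙≡𝟙 (⨾-monoʳ-≤ {a ⨾ 𝟙} {𝟙} {pair f g} x≤𝟙))
      where
      pair⨾a⨾𝟙≡𝟙 : pair f g ⨾ (a ⨾ 𝟙) ≡ 𝟙
      pair⨾a⨾𝟙≡𝟙 = trans (⨾-assoc (pair f g) a 𝟙) (trans (cong (_⨾ 𝟙) (pair-⨾-a g-tot)) f-tot)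

    pair-functional : ∀ {f g} → Functional f → Functional g → Functional (pair f g)
    pair-functional {f} {g} f-fun g-fun = ≤-trans
      (·-greatest (component-≤ (˘-mono-≤ x·y≤x) x·y≤x f-fun) (component-≤ (˘-mono-≤ x·y≤y) x·y≤y g-fun))
      a⨾a˘·b⨾b˘≤1'
      where
      component-≤ : ∀ {u h} → pair f g ˘ ≤ (h ⨾ u ˘) ˘ → pair f g ≤ h ⨾ u ˘ → Functional h →
                    pair f g ˘ ⨾ pair f g ≤ u ⨾ u ˘
      component-≤ {u} {h} ˘≤ ≤ h-fun = ≤-trans
        (⨾-mono-≤ (≤-trans ˘≤ (≤-reflexive (trans (˘-⨾ h (u ˘)) (cong (_⨾ h ˘) (˘-invol u))))) ≤)
        (functional-⨾˘⨾-≤ u (u ˘) h-fun)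

    letter : Letter → Carrier
    letter 𝐚 = a
    letter 𝐛 = b

    letter-functional : ∀ l → Functional (letter l)
    letter-functional 𝐚 = a-functional
    letter-functional 𝐛 = b-functional

    letter-total : ∀ l → Total (letter l)
    letter-total 𝐚 = a-total
    letter-total 𝐛 = b-total

    _⨾ˡ_ : Carrier → Letter → Carrier
    x ⨾ˡ l = x ⨾ letter l

    -- Left-nested and without a trailing 1', so that the leaves of the diagrams of x₀ and x₁
    -- denote literally the words occurring in A and B.
    word : Word → Carrier
    word []      = 1'
    word (l ∷ w) = foldl _⨾ˡ_ (letter l) w

    foldl-⨾ : ∀ x y w → foldl _⨾ˡ_ (x ⨾ y) w ≡ x ⨾ foldl _⨾ˡ_ y w
    foldl-⨾ x y []      = refl
    foldl-⨾ x y (l ∷ w) = trans (cong (λ t → foldl _⨾ˡ_ t w) (sym (⨾-assoc x y (letter l))))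
                                (foldl-⨾ x (y ⨾ letter l) w)

    word-∷ : ∀ l w → word (l ∷ w) ≡ letter l ⨾ word w
    word-∷ l []      = sym (⨾-identityʳ (letter l))
    word-∷ l (m ∷ w) = foldl-⨾ (letter l) (letter m) w

    word-++ : ∀ p q → word (p ++ q) ≡ word p ⨾ word q
    word-++ []      q = sym (⨾-identityˡ (word q))
    word-++ (l ∷ p) q = begin
      word (l ∷ p ++ q)             ≡⟨ word-∷ l (p ++ q) ⟩
      letter l ⨾ word (p ++ q)      ≡⟨ cong (letter l ⨾_) (word-++ p q) ⟩
      letter l ⨾ (word p ⨾ word q)  ≡⟨ ⨾-assoc (letter l) (word p) (word q) ⟩
      letter l ⨾ word p ⨾ word q    ≡⟨ cong (_⨾ word q) (sym (word-∷ l p)) ⟩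
      word (l ∷ p) ⨾ word q         ∎

    word-functional : ∀ w → Functional (word w)
    word-functional []      = 1'-functional
    word-functional (l ∷ w) =
      subst Functional (sym (word-∷ l w)) (⨾-functional (letter-functional l) (word-functional w))

    word-total : ∀ w → Total (word w)
    word-total []      = ⨾-identityˡ 𝟙
    word-total (l ∷ w) = subst Total (sym (word-∷ l w)) (total-⨾-≡𝟙 (letter-total l) (word-total w))

    ⟦_⟧ : Tree → Carrier
    ⟦ leaf w ⟧   = word w
    ⟦ node l r ⟧ = pair ⟦ l ⟧ ⟦ r ⟧

    ⟦⟧-functional : ∀ t → Functional ⟦ t ⟧
    ⟦⟧-functional (leaf w)   = word-functional w
    ⟦⟧-functional (node l r) = pair-functional (⟦⟧-functional l) (⟦⟧-functional r)

    ⟦⟧-total : ∀ t → Total ⟦ t ⟧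
    ⟦⟧-total (leaf w)   = word-total w
    ⟦⟧-total (node l r) = pair-total (⟦⟧-total l) (⟦⟧-total r)

    ⨾-word-∷ : ∀ x l p → x ⨾ word (l ∷ p) ≡ x ⨾ letter l ⨾ word p
    ⨾-word-∷ x l p = trans (cong (x ⨾_) (word-∷ l p)) (⨾-assoc x (letter l) (word p))

    act-sound : ∀ t p {q} → act t p ≡ just q → ⟦ t ⟧ ⨾ word p ≡ word q
    act-sound (leaf w)   p       refl = sym (word-++ w p)
    act-sound (node l r) (𝐚 ∷ p) eq   = trans (⨾-word-∷ ⟦ node l r ⟧ 𝐚 p)
      (trans (cong (_⨾ word p) (pair-⨾-a (⟦⟧-total r))) (act-sound l p eq))
    act-sound (node l r) (𝐛 ∷ p) eq   = trans (⨾-word-∷ ⟦ node l r ⟧ 𝐛 p)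
      (trans (cong (_⨾ word p) (pair-⨾-b (⟦⟧-total l))) (act-sound r p eq))

    ⟦_⟧ᵍ : Gen → Carrier
    ⟦ g ⟧ᵍ = ⟦ diagram g ⟧

    prod : List Gen → Carrier
    prod []       = 1'
    prod (g ∷ gs) = ⟦ g ⟧ᵍ ⨾ prod gs

    prod-++ : ∀ gs hs → prod (gs ++ hs) ≡ prod gs ⨾ prod hs
    prod-++ []       hs = sym (⨾-identityˡ (prod hs))
    prod-++ (g ∷ gs) hs = trans (cong (⟦ g ⟧ᵍ ⨾_) (prod-++ gs hs)) (⨾-assoc ⟦ g ⟧ᵍ (prod gs) (prod hs))

    prod-functional : ∀ gs → Functional (prod gs)
    prod-functional []       = 1'-functional
    prod-functional (g ∷ gs) = ⨾-functional (⟦⟧-functional (diagram g)) (prod-functional gs)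

    act*-sound : ∀ gs p {q} → act* gs p ≡ just q → prod gs ⨾ word p ≡ word q
    act*-sound []       p refl = ⨾-identityˡ (word p)
    act*-sound (g ∷ gs) p eq with act* gs p in eq′
    ... | just r = begin
      ⟦ g ⟧ᵍ ⨾ prod gs ⨾ word p   ≡⟨ sym (⨾-assoc ⟦ g ⟧ᵍ (prod gs) (word p)) ⟩
      ⟦ g ⟧ᵍ ⨾ (prod gs ⨾ word p) ≡⟨ cong (⟦ g ⟧ᵍ ⨾_) (act*-sound gs p eq′) ⟩
      ⟦ g ⟧ᵍ ⨾ word r             ≡⟨ act-sound (diagram g) r eq ⟩
      _                           ∎

    -- Two functional elements agreeing on both successors of every word agree, so fixing all
    -- words of length n propagates up to the empty word.
    fixesExtensions-sound : ∀ gs n p → FixesExtensions gs n p → prod gs ⨾ word p ≡ word p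
    fixesExtensions-sound gs zero    p fixes             = act*-sound gs p fixes
    fixesExtensions-sound gs (suc n) p (fixes-a , fixes-b) =
      functional-ext (⨾-functional (prod-functional gs) (word-functional p)) (word-functional p)
        (fixes-successor 𝐚 fixes-a) (fixes-successor 𝐛 fixes-b)
      where
      fixes-successor : ∀ l → FixesExtensions gs n (p ∷ʳ l) →
                        prod gs ⨾ word p ⨾ letter l ≡ word p ⨾ letter l
      fixes-successor l fixes = begin
        prod gs ⨾ word p ⨾ letter l   ≡⟨ sym (⨾-assoc (prod gs) (word p) (letter l)) ⟩
        prod gs ⨾ (word p ⨾ letter l) ≡⟨ cong (prod gs ⨾_) (sym (word-++ p (l ∷ []))) ⟩
        prod gs ⨾ word (p ∷ʳ l)       ≡⟨ fixesExtensions-sound gs n (p ∷ʳ l) fixes ⟩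
        word (p ∷ʳ l)                 ≡⟨ word-++ p (l ∷ []) ⟩
        word p ⨾ letter l             ∎

    prod≡1' : ∀ gs n → True (fixesExtensions? gs n []) → prod gs ≡ 1'
    prod≡1' gs n checked =
      trans (sym (⨾-identityʳ (prod gs))) (fixesExtensions-sound gs n [] (toWitness checked))

    ⨾-inv≡1' : ∀ g → ⟦ g ⟧ᵍ ⨾ ⟦ inv g ⟧ᵍ ≡ 1'
    ⨾-inv≡1' g = trans (cong (⟦ g ⟧ᵍ ⨾_) (sym (⨾-identityʳ ⟦ inv g ⟧ᵍ)))
                       (prod≡1' (g ∷ inv g ∷ []) 3 (checked g))
      where
      checked : ∀ g → True (fixesExtensions? (g ∷ inv g ∷ []) 3 [])
      checked x₀   = _
      checked x₁   = _
      checked x₀⁻¹ = _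
      checked x₁⁻¹ = _

    ˘-⟦⟧ᵍ : ∀ g → ⟦ g ⟧ᵍ ˘ ≡ ⟦ inv g ⟧ᵍ
    ˘-⟦⟧ᵍ g = ˘-unique (⟦⟧-functional (diagram g)) (⟦⟧-functional (diagram (inv g))) (⨾-inv≡1' g)
      (subst (λ h → ⟦ inv g ⟧ᵍ ⨾ ⟦ h ⟧ᵍ ≡ 1') (inv-involutive g) (⨾-inv≡1' (inv g)))

    ˘-prod : ∀ gs → prod gs ˘ ≡ prod (invs gs)
    ˘-prod []       = ˘-1'
    ˘-prod (g ∷ gs) = begin
      (⟦ g ⟧ᵍ ⨾ prod gs) ˘                   ≡⟨ ˘-⨾ ⟦ g ⟧ᵍ (prod gs) ⟩
      prod gs ˘ ⨾ ⟦ g ⟧ᵍ ˘                   ≡⟨ cong₂ _⨾_ (˘-prod gs) (˘-⟦⟧ᵍ g) ⟩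
      prod (invs gs) ⨾ ⟦ inv g ⟧ᵍ            ≡⟨ cong (prod (invs gs) ⨾_) (sym (⨾-identityʳ ⟦ inv g ⟧ᵍ)) ⟩
      prod (invs gs) ⨾ prod (inv g ∷ [])        ≡⟨ sym (prod-++ (invs gs) (inv g ∷ [])) ⟩
      prod (invs gs ∷ʳ inv g)                ≡⟨ cong prod (sym (unfold-reverse (inv g) (map inv gs))) ⟩
      prod (invs (g ∷ gs))                   ∎

    eval : Term → Carrier
    eval (gen g) = ⟦ g ⟧ᵍ
    eval (s ∙ t) = eval s ⨾ eval t
    eval (t ⁻¹)  = eval t ˘

    eval≡prod-flatten : ∀ t → eval t ≡ prod (flatten t)
    eval≡prod-flatten (gen g) = sym (⨾-identityʳ ⟦ g ⟧ᵍ)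
    eval≡prod-flatten (s ∙ t) =
      trans (cong₂ _⨾_ (eval≡prod-flatten s) (eval≡prod-flatten t))
            (sym (prod-++ (flatten s) (flatten t)))
    eval≡prod-flatten (t ⁻¹)  = trans (cong _˘ (eval≡prod-flatten t)) (˘-prod (flatten t))

    eval≡1' : ∀ t n → True (fixesExtensions? (flatten t) n []) → eval t ≡ 1'
    eval≡1' t n checked = trans (eval≡prod-flatten t) (prod≡1' (flatten t) n checked)

    relation₁ : eval (commutator (gen x₁ ⁻¹ ∙ gen x₀) (gen x₀ ∙ gen x₁ ∙ gen x₀ ⁻¹)) ≡ 1'
    relation₁ = eval≡1' (commutator (gen x₁ ⁻¹ ∙ gen x₀) (gen x₀ ∙ gen x₁ ∙ gen x₀ ⁻¹)) 4 _

    relation₂ : eval (commutator (gen x₁ ⁻¹ ∙ gen x₀)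
                                 ((gen x₀ ∙ gen x₀) ∙ gen x₁ ∙ (gen x₀ ⁻¹ ∙ gen x₀ ⁻¹))) ≡ 1'
    relation₂ = eval≡1' (commutator (gen x₁ ⁻¹ ∙ gen x₀)
                                    ((gen x₀ ∙ gen x₀) ∙ gen x₁ ∙ (gen x₀ ⁻¹ ∙ gen x₀ ⁻¹))) 5 _

    ·-⨾-a˘ : ∀ x y → (x · y) ⨾ a ˘ ≡ x ⨾ a ˘ · y ⨾ a ˘
    ·-⨾-a˘ = ⨾-distribʳ-· (functional⇒˘-injective a-functional)

    ·-⨾-b˘ : ∀ x y → (x · y) ⨾ b ˘ ≡ x ⨾ b ˘ · y ⨾ b ˘
    ·-⨾-b˘ = ⨾-distribʳ-· (functional⇒˘-injective b-functional)

    ⟦x₀⟧ᵍ≡ : ⟦ x₀ ⟧ᵍ ≡ a ⨾ (a ˘ ⨾ a ˘) · b ⨾ a ⨾ b ˘ ⨾ a ˘ · (b ⨾ b) ⨾ b ˘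
    ⟦x₀⟧ᵍ≡ = cong (_· (b ⨾ b) ⨾ b ˘)
      (trans (·-⨾-a˘ (a ⨾ a ˘) (b ⨾ a ⨾ b ˘)) (cong (_· b ⨾ a ⨾ b ˘ ⨾ a ˘) (sym (⨾-assoc a (a ˘) (a ˘)))))

    ⟦x₁⟧ᵍ≡ : ⟦ x₁ ⟧ᵍ ≡ a ⨾ a ˘ · b ⨾ a ⨾ (a ˘ ⨾ a ˘) ⨾ b ˘ · (b ⨾ b) ⨾ a ⨾ b ˘ ⨾ a ˘ ⨾ b ˘
                         · (b ⨾ b ⨾ b) ⨾ (b ˘ ⨾ b ˘)
    ⟦x₁⟧ᵍ≡ = begin
      a ⨾ a ˘ · ((b ⨾ a ⨾ a ˘ · b ⨾ b ⨾ a ⨾ b ˘) ⨾ a ˘ · b ⨾ b ⨾ b ⨾ b ˘) ⨾ b ˘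
        ≡⟨ cong (a ⨾ a ˘ ·_) (·-⨾-b˘ _ _) ⟩
      a ⨾ a ˘ · ((b ⨾ a ⨾ a ˘ · b ⨾ b ⨾ a ⨾ b ˘) ⨾ a ˘ ⨾ b ˘ · b ⨾ b ⨾ b ⨾ b ˘ ⨾ b ˘)
        ≡⟨ cong (λ t → a ⨾ a ˘ · (t ⨾ b ˘ · b ⨾ b ⨾ b ⨾ b ˘ ⨾ b ˘)) (·-⨾-a˘ _ _) ⟩
      a ⨾ a ˘ · ((b ⨾ a ⨾ a ˘ ⨾ a ˘ · b ⨾ b ⨾ a ⨾ b ˘ ⨾ a ˘) ⨾ b ˘ · b ⨾ b ⨾ b ⨾ b ˘ ⨾ b ˘)
        ≡⟨ cong (λ t → a ⨾ a ˘ · (t · b ⨾ b ⨾ b ⨾ b ˘ ⨾ b ˘)) (·-⨾-b˘ _ _) ⟩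
      a ⨾ a ˘ · (b ⨾ a ⨾ a ˘ ⨾ a ˘ ⨾ b ˘ · b ⨾ b ⨾ a ⨾ b ˘ ⨾ a ˘ ⨾ b ˘ · b ⨾ b ⨾ b ⨾ b ˘ ⨾ b ˘)
        ≡⟨ cong₂ (λ s t → a ⨾ a ˘ · (s ⨾ b ˘ · b ⨾ b ⨾ a ⨾ b ˘ ⨾ a ˘ ⨾ b ˘ · t))
             (sym (⨾-assoc (b ⨾ a) (a ˘) (a ˘))) (sym (⨾-assoc (b ⨾ b ⨾ b) (b ˘) (b ˘))) ⟩
      a ⨾ a ˘ · (b ⨾ a ⨾ (a ˘ ⨾ a ˘) ⨾ b ˘ · (b ⨾ b) ⨾ a ⨾ b ˘ ⨾ a ˘ ⨾ b ˘ · (b ⨾ b ⨾ b) ⨾ (b ˘ ⨾ b ˘))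
        ≡⟨ trans (·-assoc _ _ _) (cong (_· (b ⨾ b ⨾ b) ⨾ (b ˘ ⨾ b ˘)) (·-assoc _ _ _)) ⟩
      a ⨾ a ˘ · b ⨾ a ⨾ (a ˘ ⨾ a ˘) ⨾ b ˘ · (b ⨾ b) ⨾ a ⨾ b ˘ ⨾ a ˘ ⨾ b ˘ · (b ⨾ b ⨾ b) ⨾ (b ˘ ⨾ b ˘)
        ∎

proposition73 : ∀ {c : Level} (𝔄 : JAlgebra c) → let open JAlgebra 𝔄 in
    (a b : Carrier) →
    a ˘ ⨾ a ≤ 1' →
    b ˘ ⨾ b ≤ 1' →
    𝟙 ≡ a ˘ ⨾ b →
    𝟙 ≡ a ⨾ 𝟙 →
    a ⨾ 𝟙 ≡ b ⨾ 𝟙 →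
    a ⨾ a ˘ · b ⨾ b ˘ ≤ 1' →
    let A = a ⨾ (a ˘ ⨾ a ˘) · b ⨾ a ⨾ b ˘ ⨾ a ˘ · (b ⨾ b) ⨾ b ˘
        B = a ⨾ a ˘ · b ⨾ a ⨾ (a ˘ ⨾ a ˘) ⨾ b ˘ · (b ⨾ b) ⨾ a ⨾ b ˘ ⨾ a ˘ ⨾ b ˘
              · (b ⨾ b ⨾ b) ⨾ (b ˘ ⨾ b ˘)
    in ([ B ˘ ⨾ A , A ⨾ B ⨾ A ˘ ] ≡ 1')
       × ([ B ˘ ⨾ A , (A ⨾ A) ⨾ B ⨾ (A ˘ ⨾ A ˘) ] ≡ 1')
proposition73 𝔄 a b a-functional b-functional 𝟙≡a˘⨾b 𝟙≡a⨾𝟙 a⨾𝟙≡b⨾𝟙 a⨾a˘·b⨾b˘≤1' =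
  subst₂ (λ A B → ([ B ˘ ⨾ A , A ⨾ B ⨾ A ˘ ] ≡ 1') × ([ B ˘ ⨾ A , (A ⨾ A) ⨾ B ⨾ (A ˘ ⨾ A ˘) ] ≡ 1'))
    ⟦x₀⟧ᵍ≡ ⟦x₁⟧ᵍ≡ (relation₁ , relation₂)
  where
  open JAlgebra 𝔄
  open JAlgebraPairing.Pairing 𝔄 a b a-functional b-functional (sym 𝟙≡a˘⨾b) (sym 𝟙≡a⨾𝟙)
                                 (trans (sym a⨾𝟙≡b⨾𝟙) (sym 𝟙≡a⨾𝟙)) a⨾a˘·b⨾b˘≤1'
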